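{- Let $d$ be a positive integer, $U \leq T_d$, and $N$ the normal closure of $(bac)^d$ in $T_d$. Then $(T_d/U,a,b,c)$ is a geodesic self-dual degree-$d$-surface if and only if (1) $gUg^{ -1} \cap X = \{1\}$ for all $g \in T_d$ and $X \in \{\langle a,b\rangle, \langle a,c\rangle, \langle b,c\rangle\}$; (2) $N \leq U$; (3) $(U/N)^{\#}$ is conjugate to $U/N$ in $H_d = T_d/N$. Furthermore, every geodesic self-dual degree-$d$-surface is isomorphic to one of this form.
   Context: $T_d = \langle a,b,c \mid a^2,b^2,c^2,(ab)^3,(ac)^2,(bc)^d\rangle$ and $H_d = \langle a,b,c \mid a^2,b^2,c^2,(ab)^3,(ac)^2,(bc)^d,(bac)^d\rangle = T_d/N$. $\#:H_d\to H_d$ is the automorphism determined by $a\mapsto a$, $b\mapsto b$, $c\mapsto ac$, and $W^{\#}=\{\#(g):g\in W\}$. A surface is a quadruple $(\mathcal{F},\alpha,\beta,\gamma)$ with $\mathcal{F}$ a set and $\alpha,\beta,\gamma$ permutations of $\mathcal{F}$ such that: $\alpha,\beta,\gamma$ are fixed-point-free involutions; $\langle\alpha,\beta,\gamma\rangle$ is transitive on $\mathcal{F}$; $\alpha\beta$ consists only of 3-cycles; $\alpha\gamma$ consists only of 2-cycles. It is a degree-$d$-surface if also $\beta\gamma$ consists only of $d$-cycles. $(T_d/U,a,b,c)$ has flags the left cosets of $U$ and permutations the left multiplications by $a,b,c$. The geodesic dual of $(\mathcal{F},\alpha,\beta,\gamma)$ is $(\mathcal{F},\alpha,\beta,\alpha\gamma)$;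 an isomorphism $(\mathcal{F},\alpha,\beta,\gamma)\to(\mathcal{G},\rho,\sigma,\tau)$ is a bijection $\phi$ with $\phi^{ -1}\alpha\phi=\rho$, $\phi^{ -1}\beta\phi=\sigma$, $\phi^{ -1}\gamma\phi=\tau$; a surface is geodesic self-dual if isomorphic to its geodesic dual. -}

module Defs where

open import Level using (0ℓ)
open import Data.Nat using (ℕ; zero; suc; _≤_; _<_)
open import Data.List using (List; []; _∷_; _++_; reverse; concatMap)
open import Data.List.Properties using (++-assoc; reverse-++; reverse-involutive; unfold-reverse)
open import Data.List.Membership.Propositional using (_∈_)
open import Data.List.Relation.Unary.Any using (here; there)
open import Data.List.Relation.Unary.All using (All)
open import Data.Product using (Σ; _×_; _,_)
open import Data.Sum using (_⊎_)
open import Relation.Binary.PropositionalEquality as P using (_≡_; subst; subst₂)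
open import Relation.Binary.Bundles using (Setoid)
open import Relation.Binary.Structures using (IsEquivalence)
open import Relation.Nullary using (¬_)
open import Function.Bundles using (Inverse)

-- Words in the generators a, b, c.  All three generators are involutions
-- in T_d and H_d, so the inverse of a word is its reverse.

data Gen : Set where
  a b c : Gen

Word : Set
Word = List Gen

pow : ℕ → Word → Word
pow zero    w = []
pow (suc n) w = w ++ pow n w

-- A group presented by generators a,b,c and a list of relators:
-- the equivalence closure of inserting/deleting a relator anywhere
-- (this is the congruence generated by the relators).

data Eq (rels : List Word) : Word → Word → Set where
  ≈refl  : ∀ {w} → Eq rels w w
  ≈sym   : ∀ {v w} → Eq rels v w → Eq rels w v
  ≈trans : ∀ {u v w} → Eq rels u v → Eq rels v w → Eq rels u w
  ≈rel   : ∀ l r {x} → x ∈ rels → Eq rels (l ++ x ++ r) (l ++ r)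

Trels : ℕ → List Word
Trels d = (a ∷ a ∷ []) ∷ (b ∷ b ∷ []) ∷ (c ∷ c ∷ []) ∷ pow 3 (a ∷ b ∷ [])
        ∷ pow 2 (a ∷ c ∷ []) ∷ pow d (b ∷ c ∷ []) ∷ []

bacd : ℕ → Word
bacd d = pow d (b ∷ a ∷ c ∷ [])

Hrels : ℕ → List Word
Hrels d = Trels d ++ (bacd d ∷ [])

EqT : ℕ → Word → Word → Set
EqT d = Eq (Trels d)

EqH : ℕ → Word → Word → Set
EqH d = Eq (Hrels d)

record Subgroup (d : ℕ) : Set₁ where
  field
    mem        : Word → Set
    resp       : ∀ {v w} → EqT d v w → mem v → mem w
    one        : mem []
    mul        : ∀ {v w} → mem v → mem w → mem (v ++ w)
    inv-closed : ∀ {w} → mem w → mem (reverse w)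
open Subgroup public

data NC (d : ℕ) : Word → Set where
  nc-conj : ∀ g → NC d (g ++ bacd d ++ reverse g)
  nc-one  : NC d []
  nc-mul  : ∀ {v w} → NC d v → NC d w → NC d (v ++ w)
  nc-inv  : ∀ {w} → NC d w → NC d (reverse w)
  nc-resp : ∀ {v w} → EqT d v w → NC d v → NC d w

Pair : Gen → Gen → Gen → Set
Pair x y g = g ≡ x ⊎ g ≡ y

InGenSub : ℕ → Gen → Gen → Word → Set
InGenSub d x y h = Σ Word λ w → All (Pair x y) w × EqT d h w

TrivMeet : (d : ℕ) → Subgroup d → Gen → Gen → Set
TrivMeet d U x y = ∀ (g h : Word) → InGenSub d x y h
                   → mem U (reverse g ++ h ++ g) → EqT d h []

Cond1 : (d : ℕ) → Subgroup d → Set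
Cond1 d U = TrivMeet d U a b × TrivMeet d U a c × TrivMeet d U b c

Cond2 : (d : ℕ) → Subgroup d → Set
Cond2 d U = ∀ w → NC d w → mem U w

UmodN : (d : ℕ) → Subgroup d → Word → Set
UmodN d U w = Σ Word λ u → mem U u × EqH d w u

sharpGen : Gen → Word
sharpGen a = a ∷ []
sharpGen b = b ∷ []
sharpGen c = a ∷ c ∷ []

sharp : Word → Word
sharp = concatMap sharpGen

UmodNSharp : (d : ℕ) → Subgroup d → Word → Set
UmodNSharp d U w = Σ Word λ g → UmodN d U g × EqH d w (sharp g)

Cond3 : (d : ℕ) → Subgroup d → Set
Cond3 d U = Σ Word λ h → ∀ w →
  (UmodNSharp d U w → UmodN d U (reverse h ++ w ++ h)) ×
  (UmodN d U (reverse h ++ w ++ h) → UmodNSharp d U w)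

-- Quadruples (F, α, β, γ); F is a setoid (a set with its equality).
-- Products of permutations are read left-to-right: αβ = "first α, then β".

record Quad : Set₁ where
  field
    F      : Setoid 0ℓ 0ℓ
    α β γ  : Setoid.Carrier F → Setoid.Carrier F
    α-cong : ∀ {x y} → Setoid._≈_ F x y → Setoid._≈_ F (α x) (α y)
    β-cong : ∀ {x y} → Setoid._≈_ F x y → Setoid._≈_ F (β x) (β y)
    γ-cong : ∀ {x y} → Setoid._≈_ F x y → Setoid._≈_ F (γ x) (γ y)
open Quad public

iter : {A : Set} → ℕ → (A → A) → A → A
iter zero    f x = x
iter (suc n) f x = f (iter n f x)

module _ (Q : Quad) where
  private
    C = Setoid.Carrier (F Q)
    _≈_ = Setoid._≈_ (F Q)

  FPFInvolution : (C → C) → Set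
  FPFInvolution f = ∀ x → (f (f x) ≈ x) × ¬ (f x ≈ x)

  OnlyCycles : ℕ → (C → C) → Set
  OnlyCycles n f = ∀ x → (iter n f x ≈ x) × (∀ k → 1 ≤ k → k < n → ¬ (iter k f x ≈ x))

  act : Word → C → C
  act []       x = x
  act (a ∷ w) x = α Q (act w x)
  act (b ∷ w) x = β Q (act w x)
  act (c ∷ w) x = γ Q (act w x)

  -- ⟨α,β,γ⟩ is transitive on F (F nonempty, all flags in one orbit)
  Transitive : Set
  Transitive = C × (∀ x y → Σ Word λ w → act w x ≈ y)

  IsSurface : Set
  IsSurface = FPFInvolution (α Q) × FPFInvolution (β Q) × FPFInvolution (γ Q)
            × Transitive
            × OnlyCycles 3 (λ x → β Q (α Q x))
            × OnlyCycles 2 (λ x → γ Q (α Q x))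

  IsDegSurface : ℕ → Set
  IsDegSurface d = IsSurface × OnlyCycles d (λ x → γ Q (β Q x))

Dual : Quad → Quad
Dual Q = record
  { F = F Q ; α = α Q ; β = β Q ; γ = λ x → γ Q (α Q x)
  ; α-cong = α-cong Q ; β-cong = β-cong Q
  ; γ-cong = λ e → γ-cong Q (α-cong Q e) }

-- isomorphism: bijection φ with φ⁻¹αφ = ρ etc. (i.e. φ ∘ α = ρ ∘ φ)
record Iso (Q R : Quad) : Set where
  field
    φ    : Inverse (F Q) (F R)
    α-comm : ∀ x → Setoid._≈_ (F R) (Inverse.to φ (α Q x)) (α R (Inverse.to φ x))
    β-comm : ∀ x → Setoid._≈_ (F R) (Inverse.to φ (β Q x)) (β R (Inverse.to φ x))
    γ-comm : ∀ x → Setoid._≈_ (F R) (Inverse.to φ (γ Q x)) (γ R (Inverse.to φ x))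

IsGSDSurface : ℕ → Quad → Set
IsGSDSurface d Q = IsDegSurface Q d × Iso Q (Dual Q)

-- The coset surface (T_d/U, a, b, c): flags are left cosets gU,
-- gU = hU iff g⁻¹h ∈ U; a,b,c act by left multiplication.

revgg : (g : Gen) (x y : Word) → reverse (g ∷ x) ++ g ∷ y ≡ reverse x ++ g ∷ g ∷ y
revgg g x y = P.trans (P.cong (_++ g ∷ y) (unfold-reverse g x)) (++-assoc (reverse x) (g ∷ []) (g ∷ y))

module _ {d : ℕ} where
  cong-l : ∀ u {v w} → EqT d v w → EqT d (u ++ v) (u ++ w)
  cong-l u ≈refl = ≈refl
  cong-l u (≈sym e) = ≈sym (cong-l u e)
  cong-l u (≈trans e f) = ≈trans (cong-l u e) (cong-l u f)
  cong-l u (≈rel l r {x} m) =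
    subst₂ (EqT d) (++-assoc u l (x ++ r)) (++-assoc u l r) (≈rel (u ++ l) r m)

  cong-r : ∀ u {v w} → EqT d v w → EqT d (v ++ u) (w ++ u)
  cong-r u ≈refl = ≈refl
  cong-r u (≈sym e) = ≈sym (cong-r u e)
  cong-r u (≈trans e f) = ≈trans (cong-r u e) (cong-r u f)
  cong-r u (≈rel l r {x} m) =
    subst₂ (EqT d)
      (P.sym (P.trans (++-assoc l (x ++ r) u) (P.cong (l ++_) (++-assoc x r u))))
      (P.sym (++-assoc l r u))
      (≈rel l (r ++ u) m)

  gg∈ : ∀ g → (g ∷ g ∷ []) ∈ Trels d
  gg∈ a = here P.refl
  gg∈ b = there (here P.refl)
  gg∈ c = there (there (here P.refl))


  cancel : ∀ w → EqT d (reverse w ++ w) []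
  cancel [] = ≈refl
  cancel (g ∷ w) =
    ≈trans (subst (λ z → EqT d z (reverse w ++ w)) (P.sym (revgg g w w)) (≈rel (reverse w) w (gg∈ g)))
           (cancel w)

  gen-cong : (U : Subgroup d) → ∀ g {x y} → mem U (reverse x ++ y) → mem U (reverse (g ∷ x) ++ g ∷ y)
  gen-cong U g {x} {y} m =
    subst (mem U) (P.sym (revgg g x y)) (resp U (≈sym (≈rel (reverse x) y (gg∈ g))) m)

  cosetSetoid : Subgroup d → Setoid 0ℓ 0ℓ
  cosetSetoid U = record
    { Carrier = Word
    ; _≈_ = λ x y → mem U (reverse x ++ y)
    ; isEquivalence = record
      { refl = λ {x} → resp U (≈sym (cancel x)) (one U)
      ; sym = λ {x} {y} m → subst (mem U)
          (P.trans (reverse-++ (reverse x) y) (P.cong (reverse y ++_) (reverse-involutive x)))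
          (inv-closed U m)
      ; trans = λ {x} {y} {z} m n → resp U
          (subst (λ t → EqT d t (reverse x ++ z))
             (P.sym (P.trans (++-assoc (reverse x) y (reverse y ++ z))
                      (P.cong (reverse x ++_) (P.sym (++-assoc y (reverse y) z)))))
             (cong-l (reverse x) (cong-r z
               (subst (λ t → EqT d (t ++ reverse y) []) (reverse-involutive y) (cancel (reverse y))))))
          (mul U m n)
      }
    }

CosetSurface : (d : ℕ) → Subgroup d → Quad
CosetSurface d U = record
  { F = cosetSetoid U
  ; α = a ∷_ ; β = b ∷_ ; γ = c ∷_
  ; α-cong = λ {x} {y} → gen-cong U a {x} {y} ; β-cong = λ {x} {y} → gen-cong U b {x} {y}
  ; γ-cong = λ {x} {y} → gen-cong U c {x} {y} }

module Submission where

-- Corollary 4.15.  A word h fixes the coset gU iff g⁻¹hg ∈ U, so the axioms of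
-- a degree-d surface for (T_d/U, a, b, c) say that no conjugate of a, b, c, or of
-- (ab)ᵏ, (ac)ᵏ, (bc)ᵏ with 0 < k < 3, 2, d, lies in U.  These "surface
-- conditions" give (1), since each element of a dihedral group ⟨x,y⟩ is a
-- rotation or a conjugate of x or y.  Conversely (1) gives them once a, b, c ≠ 1
-- and ab, ac, bc have orders exactly 3, 2, d in T_d; this is read off a parity
-- representation and the representation T_d → PGL(2,ℤ/d) on ℤ² modulo d and
-- sign (d = 1 is impossible).  An isomorphism φ onto the geodesic dual satisfies
-- φ(wU) = w^#φ(U), so it exists iff U is #-stable: u ∈ U ⇔ h⁻¹u^#h ∈ U for some
-- h.  #-stability implies (2), because # kills the generators of N, and under (2)
-- it is equivalent to (3).  Finally, a degree-d surface is a transitive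
-- representation of T_d, hence the coset surface of a flag stabilizer.

open import Defs
open import Level using (0ℓ)
open import Data.Nat as ℕ using (ℕ; zero; suc; _∸_; _≤_; _<_; z≤n; s≤s)
open import Data.Nat.Properties using (<⇒≤; m≤n⇒m<n∨m≡n; m∸n+n≡m; m∸n≤m)
open import Data.Product using (Σ; ∃; _×_; _,_; proj₁; proj₂)
open import Data.Sum using (_⊎_; inj₁; inj₂)
open import Data.Empty using (⊥; ⊥-elim)
open import Data.List using (List; []; _∷_; _++_; reverse)
open import Data.List.Properties
  using (++-assoc; ++-identityʳ; reverse-++; reverse-involutive; unfold-reverse; concatMap-++)
open import Data.List.Membership.Propositional using (_∈_)
open import Data.List.Membership.Propositional.Properties using (∈-++⁺ˡ; ∈-++⁺ʳ; ∈-++⁻)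
open import Data.List.Relation.Unary.Any using (here; there)
open import Data.List.Relation.Unary.All using (All; []; _∷_)
open import Relation.Binary.Bundles using (Setoid)
open import Relation.Binary.PropositionalEquality as ≡
  using (_≡_; refl; cong; subst; subst₂)
open import Relation.Nullary using (¬_)
open import Function.Bundles using (Inverse; Equivalence; _⇔_; mk⇔)

pow-+ : ∀ m n (v : Word) → pow (m ℕ.+ n) v ≡ pow m v ++ pow n v
pow-+ zero    n v = refl
pow-+ (suc m) n v = ≡.trans (cong (v ++_) (pow-+ m n v)) (≡.sym (++-assoc v (pow m v) (pow n v)))

pow-comm : ∀ n (v : Word) → pow n v ++ v ≡ v ++ pow n v
pow-comm zero    v = ≡.sym (++-identityʳ v)
pow-comm (suc n) v = ≡.trans (++-assoc v (pow n v) v) (cong (v ++_) (pow-comm n v))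

reverse-pow : ∀ n (v : Word) → reverse (pow n v) ≡ pow n (reverse v)
reverse-pow zero    v = refl
reverse-pow (suc n) v = ≡.trans (reverse-++ v (pow n v))
  (≡.trans (cong (_++ reverse v) (reverse-pow n v)) (pow-comm n (reverse v)))

pow-shift : ∀ n (x y : Gen) → pow n (x ∷ y ∷ []) ++ x ∷ [] ≡ x ∷ pow n (y ∷ x ∷ [])
pow-shift zero    x y = refl
pow-shift (suc n) x y = cong (λ w → x ∷ y ∷ w) (pow-shift n x y)

reverse-quotient : ∀ (g h : Word) → reverse (reverse g ++ h) ≡ reverse h ++ g
reverse-quotient g h = ≡.trans (reverse-++ (reverse g) h) (cong (reverse h ++_) (reverse-involutive g))

reverse-++₃ : ∀ (u v w : Word) → reverse (u ++ v ++ w) ≡ reverse w ++ reverse v ++ reverse u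
reverse-++₃ u v w = ≡.trans (reverse-++ u (v ++ w))
  (≡.trans (cong (_++ reverse u) (reverse-++ v w)) (++-assoc (reverse w) (reverse v) (reverse u)))

reflection-step : ∀ k (x y z : Gen) g → pow k (x ∷ y ∷ []) ++ x ∷ [] ≡ g ++ z ∷ reverse g →
                  pow (suc (suc k)) (x ∷ y ∷ []) ++ x ∷ [] ≡ (x ∷ y ∷ g) ++ z ∷ reverse (x ∷ y ∷ g)
reflection-step k x y z g e = begin
  x ∷ y ∷ (x ∷ y ∷ pow k xy) ++ x ∷ []             ≡⟨ cong (λ w → x ∷ y ∷ w ++ x ∷ []) (pow-comm k xy) ⟨
  x ∷ y ∷ (pow k xy ++ x ∷ y ∷ []) ++ x ∷ []       ≡⟨ cong (λ w → x ∷ y ∷ w) (++-assoc (pow k xy) xy (x ∷ [])) ⟩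
  x ∷ y ∷ pow k xy ++ x ∷ y ∷ x ∷ []               ≡⟨ cong (λ w → x ∷ y ∷ w) (++-assoc (pow k xy) (x ∷ []) (y ∷ x ∷ [])) ⟨
  x ∷ y ∷ (pow k xy ++ x ∷ []) ++ y ∷ x ∷ []       ≡⟨ cong (λ w → x ∷ y ∷ w ++ y ∷ x ∷ []) e ⟩
  x ∷ y ∷ (g ++ z ∷ reverse g) ++ y ∷ x ∷ []       ≡⟨ cong (λ w → x ∷ y ∷ w) (++-assoc g (z ∷ reverse g) (y ∷ x ∷ [])) ⟩
  x ∷ y ∷ g ++ z ∷ reverse g ++ y ∷ x ∷ []         ≡⟨ cong (λ w → x ∷ y ∷ g ++ z ∷ w) (reverse-++ xy g) ⟨
  x ∷ y ∷ g ++ z ∷ reverse (x ∷ y ∷ g)             ∎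
  where
    open ≡.≡-Reasoning
    xy = x ∷ y ∷ []

sharp-++ : ∀ u v → sharp (u ++ v) ≡ sharp u ++ sharp v
sharp-++ = concatMap-++ sharpGen

sharp-pow : ∀ n w → sharp (pow n w) ≡ pow n (sharp w)
sharp-pow zero    w = refl
sharp-pow (suc n) w = ≡.trans (sharp-++ w (pow n w)) (cong (sharp w ++_) (sharp-pow n w))

module Presented (R : List Word) where

  setoid : Setoid 0ℓ 0ℓ
  setoid = record
    { Carrier = Word ; _≈_ = Eq R
    ; isEquivalence = record { refl = ≈refl ; sym = ≈sym ; trans = ≈trans } }

  ≡⇒≈ : ∀ {v w} → v ≡ w → Eq R v w
  ≡⇒≈ refl = ≈refl

  relator : ∀ {x} → x ∈ R → Eq R x []
  relator {x} m = subst₂ (Eq R) (++-identityʳ x) refl (≈rel [] [] m)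

  ∙-congˡ : ∀ u {v w} → Eq R v w → Eq R (u ++ v) (u ++ w)
  ∙-congˡ u ≈refl = ≈refl
  ∙-congˡ u (≈sym e) = ≈sym (∙-congˡ u e)
  ∙-congˡ u (≈trans e f) = ≈trans (∙-congˡ u e) (∙-congˡ u f)
  ∙-congˡ u (≈rel l r {x} m) =
    subst₂ (Eq R) (++-assoc u l (x ++ r)) (++-assoc u l r) (≈rel (u ++ l) r m)

  ∙-congʳ : ∀ u {v w} → Eq R v w → Eq R (v ++ u) (w ++ u)
  ∙-congʳ u ≈refl = ≈refl
  ∙-congʳ u (≈sym e) = ≈sym (∙-congʳ u e)
  ∙-congʳ u (≈trans e f) = ≈trans (∙-congʳ u e) (∙-congʳ u f)
  ∙-congʳ u (≈rel l r {x} m) =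
    subst₂ (Eq R)
      (≡.sym (≡.trans (++-assoc l (x ++ r) u) (cong (l ++_) (++-assoc x r u))))
      (≡.sym (++-assoc l r u))
      (≈rel l (r ++ u) m)

  ∙-cong : ∀ {v v′ w w′} → Eq R v v′ → Eq R w w′ → Eq R (v ++ w) (v′ ++ w′)
  ∙-cong {v′ = v′} {w = w} e f = ≈trans (∙-congʳ w e) (∙-congˡ v′ f)

  module Involutive (gg : ∀ g → (g ∷ g ∷ []) ∈ R) where
    open import Relation.Binary.Reasoning.Setoid setoid

    inverseˡ : ∀ w → Eq R (reverse w ++ w) []
    inverseˡ [] = ≈refl
    inverseˡ (g ∷ w) = begin
      reverse (g ∷ w) ++ g ∷ w         ≡⟨ cong (_++ g ∷ w) (unfold-reverse g w) ⟩
      (reverse w ++ g ∷ []) ++ g ∷ w   ≡⟨ ++-assoc (reverse w) (g ∷ []) (g ∷ w) ⟩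
      reverse w ++ g ∷ g ∷ w           ≈⟨ ≈rel (reverse w) w (gg g) ⟩
      reverse w ++ w                   ≈⟨ inverseˡ w ⟩
      []                               ∎

    inverseʳ : ∀ w → Eq R (w ++ reverse w) []
    inverseʳ w = subst (λ v → Eq R (v ++ reverse w) []) (reverse-involutive w) (inverseˡ (reverse w))

    eq⇒quotient : ∀ {v w} → Eq R v w → Eq R (reverse v ++ w) []
    eq⇒quotient {v} e = ≈trans (∙-congˡ (reverse v) (≈sym e)) (inverseˡ v)

    reverse-cong : ∀ {v w} → Eq R v w → Eq R (reverse v) (reverse w)
    reverse-cong {v} {w} e = begin
      reverse v                       ≡⟨ ++-identityʳ (reverse v) ⟨
      reverse v ++ []                 ≈⟨ ∙-congˡ (reverse v) (inverseʳ w) ⟨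
      reverse v ++ w ++ reverse w     ≈⟨ ∙-congˡ (reverse v) (∙-congʳ (reverse w) e) ⟨
      reverse v ++ v ++ reverse w     ≡⟨ ++-assoc (reverse v) v (reverse w) ⟨
      (reverse v ++ v) ++ reverse w   ≈⟨ ∙-congʳ (reverse w) (inverseˡ v) ⟩
      reverse w                       ∎

    quotient⇒eq : ∀ {v w} → Eq R (v ++ reverse w) [] → Eq R v w
    quotient⇒eq {v} {w} e = begin
      v                       ≡⟨ ++-identityʳ v ⟨
      v ++ []                 ≈⟨ ∙-congˡ v (inverseˡ w) ⟨
      v ++ reverse w ++ w     ≡⟨ ++-assoc v (reverse w) w ⟨
      (v ++ reverse w) ++ w   ≈⟨ ∙-congʳ w e ⟩
      w                       ∎

module Dihedral (R : List Word) (gg : ∀ g → (g ∷ g ∷ []) ∈ R)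
                (x y : Gen) (n : ℕ) (0<n : 0 < n)
                (rel : Eq R (pow n (x ∷ y ∷ [])) []) where
  open Presented R
  open Involutive gg
  open import Relation.Binary.Reasoning.Setoid setoid

  rotation : ℕ → Word
  rotation k = pow k (x ∷ y ∷ [])

  reflection : ℕ → Word
  reflection k = rotation k ++ x ∷ []

  NormalForm : Word → Set
  NormalForm w = ∃ λ k → k < n × (Eq R w (rotation k) ⊎ Eq R w (reflection k))

  -- (yx)ᵏ = (xy)⁻ᵏ = (xy)ⁿ⁻ᵏ
  yx-power : ∀ k → k ≤ n → Eq R (pow k (y ∷ x ∷ [])) (rotation (n ∸ k))
  yx-power k k≤n = begin
    pow k (y ∷ x ∷ [])                           ≡⟨ reverse-pow k (x ∷ y ∷ []) ⟨
    r⁻¹                                          ≈⟨ ∙-congʳ r⁻¹ rel ⟨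
    rotation n ++ r⁻¹                            ≡⟨ cong (λ m → rotation m ++ r⁻¹) (m∸n+n≡m k≤n) ⟨
    rotation (n ∸ k ℕ.+ k) ++ r⁻¹                ≡⟨ cong (_++ r⁻¹) (pow-+ (n ∸ k) k (x ∷ y ∷ [])) ⟩
    (rotation (n ∸ k) ++ rotation k) ++ r⁻¹      ≡⟨ ++-assoc (rotation (n ∸ k)) (rotation k) r⁻¹ ⟩
    rotation (n ∸ k) ++ rotation k ++ r⁻¹        ≈⟨ ∙-congˡ (rotation (n ∸ k)) (inverseʳ (rotation k)) ⟩
    rotation (n ∸ k) ++ []                       ≡⟨ ++-identityʳ (rotation (n ∸ k)) ⟩
    rotation (n ∸ k)                             ∎
    where r⁻¹ = reverse (rotation k)

  x-reflection : ∀ k → k ≤ n → Eq R (x ∷ reflection k) (rotation (n ∸ k))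
  x-reflection k k≤n = begin
    x ∷ reflection k             ≡⟨ cong (x ∷_) (pow-shift k x y) ⟩
    x ∷ x ∷ pow k (y ∷ x ∷ [])   ≈⟨ ≈rel [] (pow k (y ∷ x ∷ [])) (gg x) ⟩
    pow k (y ∷ x ∷ [])           ≈⟨ yx-power k k≤n ⟩
    rotation (n ∸ k)             ∎

  x-rotation : ∀ k → k ≤ n → Eq R (x ∷ rotation k) (reflection (n ∸ k))
  x-rotation k k≤n = begin
    x ∷ rotation k                   ≡⟨ ++-identityʳ (x ∷ rotation k) ⟨
    (x ∷ rotation k) ++ []           ≈⟨ ≈rel (x ∷ rotation k) [] (gg x) ⟨
    (x ∷ rotation k) ++ x ∷ x ∷ []   ≡⟨ ++-assoc (x ∷ rotation k) (x ∷ []) (x ∷ []) ⟨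
    (x ∷ reflection k) ++ x ∷ []     ≈⟨ ∙-congʳ (x ∷ []) (x-reflection k k≤n) ⟩
    reflection (n ∸ k)               ∎

  reduce-rotation : ∀ k → k ≤ n → ∃ λ j → j < n × Eq R (rotation k) (rotation j)
  reduce-rotation k k≤n with m≤n⇒m<n∨m≡n k≤n
  ... | inj₁ k<n = k , k<n , ≈refl
  ... | inj₂ refl = 0 , 0<n , rel

  reduce-reflection : ∀ k → k ≤ n → ∃ λ j → j < n × Eq R (reflection k) (reflection j)
  reduce-reflection k k≤n with m≤n⇒m<n∨m≡n k≤n
  ... | inj₁ k<n = k , k<n , ≈refl
  ... | inj₂ refl = 0 , 0<n , ∙-congʳ (x ∷ []) rel

  prepend-x : ∀ {w} → NormalForm w → NormalForm (x ∷ w)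
  prepend-x (k , k<n , inj₁ e) with reduce-reflection (n ∸ k) (m∸n≤m n k)
  ... | j , j<n , e′ = j , j<n , inj₂ (≈trans (∙-congˡ (x ∷ []) e) (≈trans (x-rotation k (<⇒≤ k<n)) e′))
  prepend-x (k , k<n , inj₂ e) with reduce-rotation (n ∸ k) (m∸n≤m n k)
  ... | j , j<n , e′ = j , j<n , inj₁ (≈trans (∙-congˡ (x ∷ []) e) (≈trans (x-reflection k (<⇒≤ k<n)) e′))

  prepend-xy : ∀ {w} → NormalForm w → NormalForm (x ∷ y ∷ w)
  prepend-xy (k , k<n , inj₁ e) with reduce-rotation (suc k) k<n
  ... | j , j<n , e′ = j , j<n , inj₁ (≈trans (∙-congˡ (x ∷ y ∷ []) e) e′)
  prepend-xy (k , k<n , inj₂ e) with reduce-reflection (suc k) k<n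
  ... | j , j<n , e′ = j , j<n , inj₂ (≈trans (∙-congˡ (x ∷ y ∷ []) e) e′)

  -- y = x·xy, so prepending y is prepending xy and then x
  prepend-y : ∀ {w} → NormalForm w → NormalForm (y ∷ w)
  prepend-y {w} nw with prepend-x (prepend-xy nw)
  ... | k , k<n , inj₁ e = k , k<n , inj₁ (≈trans (≈sym (≈rel [] (y ∷ w) (gg x))) e)
  ... | k , k<n , inj₂ e = k , k<n , inj₂ (≈trans (≈sym (≈rel [] (y ∷ w) (gg x))) e)

  normalForm : ∀ w → All (Pair x y) w → NormalForm w
  normalForm [] [] = 0 , 0<n , inj₁ ≈refl
  normalForm (_ ∷ w) (inj₁ refl ∷ p) = prepend-x (normalForm w p)
  normalForm (_ ∷ w) (inj₂ refl ∷ p) = prepend-y (normalForm w p)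

  -- (xy)ᵏx = g x g⁻¹ (k even) or g y g⁻¹ (k odd)
  reflection-conjugate : ∀ k → ∃ λ g → reflection k ≡ g ++ x ∷ reverse g ⊎ reflection k ≡ g ++ y ∷ reverse g
  reflection-conjugate zero = [] , inj₁ refl
  reflection-conjugate (suc zero) = x ∷ [] , inj₂ refl
  reflection-conjugate (suc (suc k)) with reflection-conjugate k
  ... | g , inj₁ e = x ∷ y ∷ g , inj₁ (reflection-step k x y x g e)
  ... | g , inj₂ e = x ∷ y ∷ g , inj₂ (reflection-step k x y y g e)

-- If the relators of T_d act
-- trivially, the quadruple is a representation of T_d: words equal in T_d act
-- equally, so a word moving some point is nontrivial in T_d.

module Action (Q : Quad) where
  private
    module F = Setoid (F Q)
  open F using (_≈_)

  act-++ : ∀ u v x → act Q (u ++ v) x ≡ act Q u (act Q v x)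
  act-++ [] v x = refl
  act-++ (a ∷ u) v x = cong (α Q) (act-++ u v x)
  act-++ (b ∷ u) v x = cong (β Q) (act-++ u v x)
  act-++ (c ∷ u) v x = cong (γ Q) (act-++ u v x)

  act-cong : ∀ w {x y} → x ≈ y → act Q w x ≈ act Q w y
  act-cong [] e = e
  act-cong (a ∷ w) e = α-cong Q (act-cong w e)
  act-cong (b ∷ w) e = β-cong Q (act-cong w e)
  act-cong (c ∷ w) e = γ-cong Q (act-cong w e)

  act-pow : ∀ n w x → act Q (pow n w) x ≡ iter n (act Q w) x
  act-pow zero w x = refl
  act-pow (suc n) w x = ≡.trans (act-++ w (pow n w) x) (cong (act Q w) (act-pow n w x))

  record Represents (d : ℕ) : Set where
    constructor representation
    field relator : ∀ {r} → r ∈ Trels d → ∀ x → act Q r x ≈ x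

  module _ {d : ℕ} (rep : Represents d) where

    act-resp : ∀ {v w} → EqT d v w → ∀ x → act Q v x ≈ act Q w x
    act-resp ≈refl x = F.refl
    act-resp (≈sym e) x = F.sym (act-resp e x)
    act-resp (≈trans e f) x = F.trans (act-resp e x) (act-resp f x)
    act-resp (≈rel l r {y} m) x =
      F.trans (F.reflexive (≡.trans (act-++ l (y ++ r) x) (cong (act Q l) (act-++ y r x))))
      (F.trans (act-cong l (Represents.relator rep m (act Q r x))) (F.reflexive (≡.sym (act-++ l r x))))

    separate : ∀ w x → ¬ act Q w x ≈ x → ¬ EqT d w []
    separate w x moved e = moved (act-resp e x)

-- The facts about T_d needed to read surface conditions off condition (1):
-- a, b, c are nontrivial and ab, ac, bc have orders exactly 3, 2 and d.

ExactOrder : ℕ → Gen → Gen → ℕ → Set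
ExactOrder d x y n = ∀ k → 1 ≤ k → k < n → ¬ EqT d (pow k (x ∷ y ∷ [])) []

record Separation (d : ℕ) : Set where
  field
    generator : ∀ g → ¬ EqT d (g ∷ []) []
    order-ab  : ExactOrder d a b 3
    order-ac  : ExactOrder d a c 2
    order-bc  : ExactOrder d b c d

iter-identity : ∀ {A : Set} (f : A → A) → (∀ x → f x ≡ x) → ∀ n x → iter n f x ≡ x
iter-identity f f≡id zero x = refl
iter-identity f f≡id (suc n) x = ≡.trans (f≡id (iter n f x)) (iter-identity f f≡id n x)

-- Parity: every generator flips a bit, and every relator has even length.

module Parity where
  open import Data.Bool using (Bool; true; false; not)
  open import Data.Bool.Properties using (not-involutive)

  parity : Quad
  parity = record
    { F = ≡.setoid Bool ; α = not ; β = not ; γ = not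
    ; α-cong = cong not ; β-cong = cong not ; γ-cong = cong not }

  relators : ∀ d {r} → r ∈ Trels d → ∀ x → act parity r x ≡ x
  relators d (here refl) = not-involutive
  relators d (there (here refl)) = not-involutive
  relators d (there (there (here refl))) = not-involutive
  relators d (there (there (there (here refl)))) = λ { true → refl ; false → refl }
  relators d (there (there (there (there (here refl))))) = λ { true → refl ; false → refl }
  relators d (there (there (there (there (there (here refl)))))) x =
    ≡.trans (Action.act-pow parity d (b ∷ c ∷ []) x) (iter-identity _ not-involutive d x)

  represents : ∀ d → Action.Represents parity d
  represents d = Action.representation (relators d)

  generator≠1 : ∀ d g → ¬ EqT d (g ∷ []) []
  generator≠1 d a = Action.separate parity (represents d) (a ∷ []) true λ ()
  generator≠1 d b = Action.separate parity (represents d) (b ∷ []) true λ ()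
  generator≠1 d c = Action.separate parity (represents d) (c ∷ []) true λ ()

  -- the odd-length word bac is nontrivial
  bac≠1 : ∀ d → ¬ EqT d (b ∷ a ∷ c ∷ []) []
  bac≠1 d = Action.separate parity (represents d) (b ∷ a ∷ c ∷ []) true λ ()

-- The modular representation, through T_d → PGL(2,ℤ) → GL(2,ℤ/d)/{±1}.
-- On ℤ², let a, b, c act by (x,y) ↦ (y,x), (y−x,y), (−x,y).  Then a², b², c²
-- act trivially, (ab)³ and (ac)² act as −1, and (bc)ᵏ as (x,y) ↦ (x+ky,y); so
-- T_d acts on ℤ² modulo d and up to sign, and there bc has order exactly d.

module Modular (d : ℕ) where
  open import Data.Integer using (ℤ; +_; -_; _+_; _-_; _*_; ∣_∣)
  open import Data.Integer.Properties using (neg-involutive; pos-+; +-inverseʳ)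
  open import Data.Integer.Divisibility.Signed
    using (_∣_; divides; ∣m∣n⇒∣m+n; ∣m∣n⇒∣m-n; ∣m⇒∣-m; ∣m⇒∣m*n; ∣-refl; ∣⇒∣ᵤ)
  open import Data.Integer.Tactic.RingSolver using (solve-∀)
  open import Data.Nat.Divisibility using (∣⇒≤)
  open import Data.Nat.Base using (>-nonZero)
  open import Data.Nat.Properties using (<⇒≱)

  infix 4 _≋_ _≋ᵥ_ _≈_

  record _≋_ (x y : ℤ) : Set where
    constructor mod
    field difference : + d ∣ x - y

  ≋-reflexive : ∀ {x y} → x ≡ y → x ≋ y
  ≋-reflexive {x} refl = mod (divides (+ 0) (+-inverseʳ x))

  ≋-refl : ∀ {x} → x ≋ x
  ≋-refl = ≋-reflexive refl

  ≋-sym : ∀ {x y} → x ≋ y → y ≋ x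
  ≋-sym {x} {y} (mod p) = mod (subst (+ d ∣_) (identity x y) (∣m⇒∣-m p))
    where
      identity : ∀ x y → - (x - y) ≡ y - x
      identity = solve-∀

  ≋-trans : ∀ {x y z} → x ≋ y → y ≋ z → x ≋ z
  ≋-trans {x} {y} {z} (mod p) (mod q) = mod (subst (+ d ∣_) (identity x y z) (∣m∣n⇒∣m+n p q))
    where
      identity : ∀ x y z → (x - y) + (y - z) ≡ x - z
      identity = solve-∀

  ≋-neg : ∀ {x x′} → x ≋ x′ → - x ≋ - x′
  ≋-neg {x} {x′} (mod p) = mod (subst (+ d ∣_) (identity x x′) (∣m⇒∣-m p))
    where
      identity : ∀ x x′ → - (x - x′) ≡ - x - - x′
      identity = solve-∀

  ≋-sub : ∀ {x x′ y y′} → x ≋ x′ → y ≋ y′ → x - y ≋ x′ - y′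
  ≋-sub {x} {x′} {y} {y′} (mod p) (mod q) = mod (subst (+ d ∣_) (identity x x′ y y′) (∣m∣n⇒∣m-n p q))
    where
      identity : ∀ x x′ y y′ → (x - x′) - (y - y′) ≡ (x - y) - (x′ - y′)
      identity = solve-∀

  V : Set
  V = ℤ × ℤ

  record _≋ᵥ_ (v w : V) : Set where
    constructor _,_
    field
      first  : proj₁ v ≋ proj₁ w
      second : proj₂ v ≋ proj₂ w

  ≋ᵥ-refl : ∀ {v} → v ≋ᵥ v
  ≋ᵥ-refl = ≋-refl , ≋-refl

  ≋ᵥ-sym : ∀ {v w} → v ≋ᵥ w → w ≋ᵥ v
  ≋ᵥ-sym (p , q) = ≋-sym p , ≋-sym q

  ≋ᵥ-trans : ∀ {u v w} → u ≋ᵥ v → v ≋ᵥ w → u ≋ᵥ w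
  ≋ᵥ-trans (p , q) (p′ , q′) = ≋-trans p p′ , ≋-trans q q′

  neg : V → V
  neg (x , y) = - x , - y

  neg-cong : ∀ {v w} → v ≋ᵥ w → neg v ≋ᵥ neg w
  neg-cong (p , q) = ≋-neg p , ≋-neg q

  neg-neg : ∀ v → neg (neg v) ≋ᵥ v
  neg-neg (x , y) = ≋-reflexive (neg-involutive x) , ≋-reflexive (neg-involutive y)

  _≈_ : V → V → Set
  v ≈ w = v ≋ᵥ w ⊎ v ≋ᵥ neg w

  ≈-sym : ∀ {v w} → v ≈ w → w ≈ v
  ≈-sym (inj₁ p) = inj₁ (≋ᵥ-sym p)
  ≈-sym {v} {w} (inj₂ p) = inj₂ (≋ᵥ-trans (≋ᵥ-sym (neg-neg w)) (neg-cong (≋ᵥ-sym p)))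

  ≈-trans : ∀ {u v w} → u ≈ v → v ≈ w → u ≈ w
  ≈-trans (inj₁ p) (inj₁ q) = inj₁ (≋ᵥ-trans p q)
  ≈-trans (inj₁ p) (inj₂ q) = inj₂ (≋ᵥ-trans p q)
  ≈-trans (inj₂ p) (inj₁ q) = inj₂ (≋ᵥ-trans p (neg-cong q))
  ≈-trans {w = w} (inj₂ p) (inj₂ q) = inj₁ (≋ᵥ-trans p (≋ᵥ-trans (neg-cong q) (neg-neg w)))

  space : Setoid 0ℓ 0ℓ
  space = record
    { Carrier = V ; _≈_ = _≈_
    ; isEquivalence = record { refl = inj₁ ≋ᵥ-refl ; sym = ≈-sym ; trans = ≈-trans } }

  respects-≈ : (f : V → V) → (∀ {v w} → v ≋ᵥ w → f v ≋ᵥ f w) → (∀ v → f (neg v) ≋ᵥ neg (f v)) →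
               ∀ {v w} → v ≈ w → f v ≈ f w
  respects-≈ f f-cong f-neg (inj₁ p) = inj₁ (f-cong p)
  respects-≈ f f-cong f-neg {w = w} (inj₂ p) = inj₂ (≋ᵥ-trans (f-cong p) (f-neg w))

  ρa ρb ρc : V → V
  ρa (x , y) = y , x
  ρb (x , y) = y - x , y
  ρc (x , y) = - x , y

  ρb-neg : ∀ v → ρb (neg v) ≋ᵥ neg (ρb v)
  ρb-neg (x , y) = ≋-reflexive (identity x y) , ≋-refl
    where
      identity : ∀ x y → - y - - x ≡ - (y - x)
      identity = solve-∀

  modular : Quad
  modular = record
    { F = space ; α = ρa ; β = ρb ; γ = ρc
    ; α-cong = respects-≈ ρa (λ { {_ , _} {_ , _} (p , q) → q , p }) (λ { (_ , _) → ≋ᵥ-refl })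
    ; β-cong = respects-≈ ρb (λ { {_ , _} {_ , _} (p , q) → ≋-sub q p , q }) ρb-neg
    ; γ-cong = respects-≈ ρc (λ { {_ , _} {_ , _} (p , q) → ≋-neg p , q }) (λ { (_ , _) → ≋ᵥ-refl }) }

  open Action modular using (Represents; representation; separate)

  bc-power : ∀ k x y → act modular (pow k (b ∷ c ∷ [])) (x , y) ≡ (x + + k * y , y)
  bc-power zero x y = cong (_, y) (identity x y)
    where
      identity : ∀ x y → x ≡ x + + 0 * y
      identity = solve-∀
  bc-power (suc k) x y rewrite bc-power k x y | pos-+ 1 k = cong (_, y) (identity x y (+ k))
    where
      identity : ∀ x y k → y - - (x + k * y) ≡ x + (+ 1 + k) * y
      identity = solve-∀

  relators : ∀ {r} → r ∈ Trels d → ∀ v → act modular r v ≈ v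
  relators (here refl) (x , y) = inj₁ ≋ᵥ-refl
  relators (there (here refl)) (x , y) = inj₁ (≋-reflexive (identity x y) , ≋-refl)
    where
      identity : ∀ x y → y - (y - x) ≡ x
      identity = solve-∀
  relators (there (there (here refl))) (x , y) = inj₁ (≋-reflexive (neg-involutive x) , ≋-refl)
  relators (there (there (there (here refl)))) (x , y) =
    inj₂ (≋-reflexive (identity₁ x y) , ≋-reflexive (identity₂ x y))
    where
      identity₁ : ∀ x y → (y - x) - y ≡ - x
      identity₁ = solve-∀
      identity₂ : ∀ x y → ((y - x) - y) - (y - x) ≡ - y
      identity₂ = solve-∀
  relators (there (there (there (there (here refl))))) (x , y) = inj₂ ≋ᵥ-refl
  relators (there (there (there (there (there (here refl)))))) (x , y)
    rewrite bc-power d x y = inj₁ (mod (subst (+ d ∣_) (identity x y (+ d)) (∣m⇒∣m*n y ∣-refl)) , ≋-refl)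
    where
      identity : ∀ x y n → n * y ≡ (x + n * y) - x
      identity = solve-∀

  represents : Represents d
  represents = representation relators

  indivisible : ∀ {z} → 0 < ∣ z ∣ → ∣ z ∣ < d → ¬ + d ∣ z
  indivisible 0<z z<d p = <⇒≱ z<d (∣⇒≤ ⦃ >-nonZero 0<z ⦄ (∣⇒∣ᵤ p))

  module _ (2≤d : 2 ≤ d) where

    -- ab, (ab)² and ac move (1,0) to (0,−1), (−1,−1) and (0,−1), none of which
    -- is ±(1,0) modulo d
    ab≠1 : ¬ EqT d (pow 1 (a ∷ b ∷ [])) []
    ab≠1 = separate represents (pow 1 (a ∷ b ∷ [])) (+ 1 , + 0)
      λ { (inj₁ (_ , mod p)) → indivisible (s≤s z≤n) 2≤d p
        ; (inj₂ (_ , mod p)) → indivisible (s≤s z≤n) 2≤d p }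

    ab²≠1 : ¬ EqT d (pow 2 (a ∷ b ∷ [])) []
    ab²≠1 = separate represents (pow 2 (a ∷ b ∷ [])) (+ 1 , + 0)
      λ { (inj₁ (_ , mod p)) → indivisible (s≤s z≤n) 2≤d p
        ; (inj₂ (_ , mod p)) → indivisible (s≤s z≤n) 2≤d p }

    ac≠1 : ¬ EqT d (pow 1 (a ∷ c ∷ [])) []
    ac≠1 = separate represents (pow 1 (a ∷ c ∷ [])) (+ 1 , + 0)
      λ { (inj₁ (_ , mod p)) → indivisible (s≤s z≤n) 2≤d p
        ; (inj₂ (_ , mod p)) → indivisible (s≤s z≤n) 2≤d p }

  -- (bc)ᵏ moves (0,1) to (k,1), which is not ±(0,1) modulo d for 0 < k < d
  order-bc : ExactOrder d b c d
  order-bc k 1≤k k<d = separate represents (pow k (b ∷ c ∷ [])) (+ 0 , + 1) moved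
    where
      identity : ∀ z → (+ 0 + z * + 1) - + 0 ≡ z
      identity = solve-∀
      k≢0 : ¬ (+ d ∣ (+ 0 + + k * + 1) - + 0)
      k≢0 p = indivisible 1≤k k<d (subst (+ d ∣_) (identity (+ k)) p)
      moved : ¬ act modular (pow k (b ∷ c ∷ [])) (+ 0 , + 1) ≈ (+ 0 , + 1)
      moved e with subst (_≈ (+ 0 , + 1)) (bc-power k (+ 0) (+ 1)) e
      ... | inj₁ (mod p , _) = k≢0 p
      ... | inj₂ (mod p , _) = k≢0 p

separation : ∀ d → 2 ≤ d → Separation d
separation d 2≤d = record
  { generator = Parity.generator≠1 d
  ; order-ab = λ { zero () _
                 ; 1 _ _ → ab≠1 2≤d
                 ; 2 _ _ → ab²≠1 2≤d
                 ; (suc (suc (suc k))) _ (s≤s (s≤s (s≤s ()))) }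
  ; order-ac = λ { zero () _
                 ; 1 _ _ → ac≠1 2≤d
                 ; (suc (suc k)) _ (s≤s (s≤s ())) }
  ; order-bc = order-bc }
  where open Modular d

module Groups (d : ℕ) where
  module T = Presented (Trels d)
  module H = Presented (Hrels d)
  involution : ∀ g → (g ∷ g ∷ []) ∈ Trels d
  involution = gg∈ {d}

  module TI = T.Involutive involution

  T⇒H : ∀ {v w} → EqT d v w → EqH d v w
  T⇒H ≈refl = ≈refl
  T⇒H (≈sym e) = ≈sym (T⇒H e)
  T⇒H (≈trans e f) = ≈trans (T⇒H e) (T⇒H f)
  T⇒H (≈rel l r m) = ≈rel l r (∈-++⁺ˡ m)

  ab³ : EqT d (pow 3 (a ∷ b ∷ [])) []
  ab³ = T.relator (there (there (there (here refl))))

  ac² : EqT d (pow 2 (a ∷ c ∷ [])) []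
  ac² = T.relator (there (there (there (there (here refl)))))

  bcᵈ : EqT d (pow d (b ∷ c ∷ [])) []
  bcᵈ = T.relator (there (there (there (there (there (here refl))))))

  bacᵈ : EqH d (bacd d) []
  bacᵈ = H.relator (∈-++⁺ʳ (Trels d) (here refl))

  ac≈ca : EqT d (a ∷ c ∷ []) (c ∷ a ∷ [])
  ac≈ca = TI.quotient⇒eq ac²

  -- #((bac)ᵈ) = (baac)ᵈ = (bc)ᵈ = 1 already in T_d
  sharp-bacᵈ : EqT d (sharp (bacd d)) []
  sharp-bacᵈ = ≈trans (T.≡⇒≈ (sharp-pow d (b ∷ a ∷ c ∷ [])))
    (≈trans (pow-cong d (≈rel (b ∷ []) (c ∷ []) (involution a))) bcᵈ)
    where
      pow-cong : ∀ n {v w} → EqT d v w → EqT d (pow n v) (pow n w)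
      pow-cong zero e = ≈refl
      pow-cong (suc n) e = T.∙-cong e (pow-cong n e)

  -- # permutes the relators of H_d up to equality, so it is an endomorphism of H_d
  sharp-relator : ∀ {x} → x ∈ Hrels d → EqH d (sharp x) []
  sharp-relator (here refl) = H.relator (here refl)
  sharp-relator (there (here refl)) = H.relator (there (here refl))
  sharp-relator (there (there (here refl))) = H.relator (there (there (there (there (here refl)))))
  sharp-relator (there (there (there (here refl)))) = H.relator (there (there (there (here refl))))
  sharp-relator (there (there (there (there (here refl))))) =
    ≈trans (≈rel [] (c ∷ a ∷ a ∷ c ∷ []) (∈-++⁺ˡ (involution a)))
    (≈trans (≈rel (c ∷ []) (c ∷ []) (∈-++⁺ˡ (involution a))) (H.relator (there (there (here refl)))))
  sharp-relator (there (there (there (there (there (here refl)))))) =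
    ≈trans (H.≡⇒≈ (sharp-pow d (b ∷ c ∷ []))) bacᵈ
  sharp-relator (there (there (there (there (there (there (here refl))))))) = T⇒H sharp-bacᵈ

  sharp-cong : ∀ {v w} → EqH d v w → EqH d (sharp v) (sharp w)
  sharp-cong ≈refl = ≈refl
  sharp-cong (≈sym e) = ≈sym (sharp-cong e)
  sharp-cong (≈trans e f) = ≈trans (sharp-cong e) (sharp-cong f)
  sharp-cong (≈rel l r {x} m) =
    ≈trans (H.≡⇒≈ (≡.trans (sharp-++ l (x ++ r)) (cong (sharp l ++_) (sharp-++ x r))))
    (≈trans (H.∙-congˡ (sharp l) (H.∙-congʳ (sharp r) (sharp-relator m)))
    (H.≡⇒≈ (≡.sym (sharp-++ l r))))

  sharp-involutive : ∀ w → EqT d (sharp (sharp w)) w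
  sharp-involutive [] = ≈refl
  sharp-involutive (a ∷ w) = T.∙-congˡ (a ∷ []) (sharp-involutive w)
  sharp-involutive (b ∷ w) = T.∙-congˡ (b ∷ []) (sharp-involutive w)
  sharp-involutive (c ∷ w) =
    ≈trans (≈rel [] (c ∷ sharp (sharp w)) (involution a)) (T.∙-congˡ (c ∷ []) (sharp-involutive w))

  sharp-reverse : ∀ w → EqT d (sharp (reverse w)) (reverse (sharp w))
  sharp-reverse [] = ≈refl
  sharp-reverse (g ∷ w) =
    ≈trans (T.≡⇒≈ (≡.trans (cong sharp (unfold-reverse g w)) (sharp-++ (reverse w) (g ∷ []))))
    (≈trans (T.∙-cong (sharp-reverse w) (generator g))
    (T.≡⇒≈ (≡.sym (reverse-++ (sharpGen g) (sharp w)))))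
    where
      generator : ∀ g → EqT d (sharp (g ∷ [])) (reverse (sharpGen g))
      generator a = ≈refl
      generator b = ≈refl
      generator c = ac≈ca

  sharp-quotient : ∀ g h → EqT d (sharp (reverse g ++ h)) (reverse (sharp g) ++ sharp h)
  sharp-quotient g h = ≈trans (T.≡⇒≈ (sharp-++ (reverse g) h)) (T.∙-congʳ (sharp h) (sharp-reverse g))

  sharp-conjugate-bacᵈ : ∀ g → EqT d (sharp (g ++ bacd d ++ reverse g)) []
  sharp-conjugate-bacᵈ g = begin
    sharp (g ++ bacd d ++ reverse g)                      ≡⟨ ≡.trans (sharp-++ g _) (cong (sharp g ++_) (sharp-++ (bacd d) (reverse g))) ⟩
    sharp g ++ sharp (bacd d) ++ sharp (reverse g)        ≈⟨ T.∙-congˡ (sharp g) (T.∙-cong sharp-bacᵈ (sharp-reverse g)) ⟩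
    sharp g ++ reverse (sharp g)                          ≈⟨ TI.inverseʳ (sharp g) ⟩
    []                                                    ∎
    where open import Relation.Binary.Reasoning.Setoid T.setoid

  conjugate-bacᵈ⁻¹ : ∀ r → NC d (reverse r ++ reverse (bacd d) ++ r)
  conjugate-bacᵈ⁻¹ r = subst (NC d) eq (nc-inv (nc-conj (reverse r)))
    where
      eq : reverse (reverse r ++ bacd d ++ reverse (reverse r)) ≡ reverse r ++ reverse (bacd d) ++ r
      eq = ≡.trans (reverse-++₃ (reverse r) (bacd d) (reverse (reverse r)))
             (≡.trans (cong (λ w → w ++ reverse (bacd d) ++ reverse (reverse r)) (reverse-involutive (reverse r)))
                      (cong (λ w → reverse r ++ reverse (bacd d) ++ w) (reverse-involutive r)))

  H-quotient∈N : ∀ {x y} → EqH d x y → NC d (reverse x ++ y)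
  H-quotient∈N {x} ≈refl = nc-resp (≈sym (TI.inverseˡ x)) nc-one
  H-quotient∈N {x} {y} (≈sym e) = subst (NC d) (reverse-quotient y x) (nc-inv (H-quotient∈N e))
  H-quotient∈N {x} {z} (≈trans {v = y} e f) = nc-resp eq (nc-mul (H-quotient∈N e) (H-quotient∈N f))
    where
      open import Relation.Binary.Reasoning.Setoid T.setoid
      eq : EqT d ((reverse x ++ y) ++ reverse y ++ z) (reverse x ++ z)
      eq = begin
        (reverse x ++ y) ++ reverse y ++ z   ≡⟨ ++-assoc (reverse x) y (reverse y ++ z) ⟩
        reverse x ++ y ++ reverse y ++ z     ≡⟨ cong (reverse x ++_) (++-assoc y (reverse y) z) ⟨
        reverse x ++ (y ++ reverse y) ++ z   ≈⟨ T.∙-congˡ (reverse x) (T.∙-congʳ z (TI.inverseʳ y)) ⟩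
        reverse x ++ z                       ∎
  H-quotient∈N (≈rel l r {x} m) with ∈-++⁻ (Trels d) m
  ... | inj₁ m′ = nc-resp (≈sym (TI.eq⇒quotient (≈rel l r m′))) nc-one
  ... | inj₂ (here refl) = nc-resp (≈sym eq) (conjugate-bacᵈ⁻¹ r)
    where
      open import Relation.Binary.Reasoning.Setoid T.setoid
      B = bacd d
      eq : EqT d (reverse (l ++ B ++ r) ++ l ++ r) (reverse r ++ reverse B ++ r)
      eq = begin
        reverse (l ++ B ++ r) ++ l ++ r                    ≡⟨ cong (_++ l ++ r) (reverse-++₃ l B r) ⟩
        (reverse r ++ reverse B ++ reverse l) ++ l ++ r    ≡⟨ ≡.trans (++-assoc (reverse r) _ (l ++ r))
                                                               (cong (reverse r ++_) (++-assoc (reverse B) (reverse l) (l ++ r))) ⟩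
        reverse r ++ reverse B ++ reverse l ++ l ++ r      ≡⟨ cong (λ w → reverse r ++ reverse B ++ w) (++-assoc (reverse l) l r) ⟨
        reverse r ++ reverse B ++ (reverse l ++ l) ++ r    ≈⟨ T.∙-congˡ (reverse r) (T.∙-congˡ (reverse B) (T.∙-congʳ r (TI.inverseˡ l))) ⟩
        reverse r ++ reverse B ++ r                        ∎
  ... | inj₂ (there ())

module Cosets (d : ℕ) (U : Subgroup d) where
  open Groups d
  open Equivalence using (to; from)

  Q : Quad
  Q = CosetSurface d U

  -- gU = hU; the wrapper keeps g and h visible to type inference
  record _~_ (g h : Word) : Set where
    constructor coset
    field same : mem U (reverse g ++ h)
  open _~_ public

  private
    module S = Setoid (cosetSetoid {d} U)

  ~-refl : ∀ {g} → g ~ g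
  ~-refl {g} = coset (S.refl {g})

  ~-sym : ∀ {g h} → g ~ h → h ~ g
  ~-sym {g} {h} (coset p) = coset (S.sym {g} {h} p)

  ~-trans : ∀ {g h k} → g ~ h → h ~ k → g ~ k
  ~-trans {g} {h} {k} (coset p) (coset q) = coset (S.trans {g} {h} {k} p q)

  EqT⇒~ : ∀ {g h} → EqT d g h → g ~ h
  EqT⇒~ e = coset (resp U (≈sym (TI.eq⇒quotient e)) (one U))

  ~-congˡ : ∀ v {g h} → g ~ h → (v ++ g) ~ (v ++ h)
  ~-congˡ v {g} {h} (coset p) = coset (resp U eq p)
    where
      open import Relation.Binary.Reasoning.Setoid T.setoid
      eq : EqT d (reverse g ++ h) (reverse (v ++ g) ++ v ++ h)
      eq = ≈sym (begin
        reverse (v ++ g) ++ v ++ h          ≡⟨ cong (_++ v ++ h) (reverse-++ v g) ⟩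
        (reverse g ++ reverse v) ++ v ++ h  ≡⟨ ++-assoc (reverse g) (reverse v) (v ++ h) ⟩
        reverse g ++ reverse v ++ v ++ h    ≡⟨ cong (reverse g ++_) (++-assoc (reverse v) v h) ⟨
        reverse g ++ (reverse v ++ v) ++ h  ≈⟨ T.∙-congˡ (reverse g) (T.∙-congʳ h (TI.inverseˡ v)) ⟩
        reverse g ++ h                      ∎)

  act-coset : ∀ w g → act Q w g ≡ w ++ g
  act-coset [] g = refl
  act-coset (a ∷ w) g = cong (a ∷_) (act-coset w g)
  act-coset (b ∷ w) g = cong (b ∷_) (act-coset w g)
  act-coset (c ∷ w) g = cong (c ∷_) (act-coset w g)

  transitive : Transitive Q
  transitive = [] , λ g h → h ++ reverse g ,
    same (subst (_~ h) (≡.sym (act-coset (h ++ reverse g) g)) (EqT⇒~ (right-cancel g h)))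
    where
      right-cancel : ∀ g h → EqT d ((h ++ reverse g) ++ g) h
      right-cancel g h = ≈trans (T.≡⇒≈ (++-assoc h (reverse g) g))
        (≈trans (T.∙-congˡ h (TI.inverseˡ g)) (T.≡⇒≈ (++-identityʳ h)))

  Fixes : Word → Word → Set
  Fixes h g = mem U (reverse g ++ h ++ g)

  Fixes-resp : ∀ {h h′} g → EqT d h h′ → Fixes h g → Fixes h′ g
  Fixes-resp g e = resp U (T.∙-congˡ (reverse g) (T.∙-congʳ g e))

  trivial-fixes : ∀ {h} g → EqT d h [] → Fixes h g
  trivial-fixes g e = Fixes-resp g (≈sym e) (resp U (≈sym (TI.inverseˡ g)) (one U))

  moved⇔fixes : ∀ h g → ((h ++ g) ~ g) ⇔ Fixes (reverse h) g
  moved⇔fixes h g = mk⇔ (λ p → subst (mem U) eq (same p)) (λ p → coset (subst (mem U) (≡.sym eq) p))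
    where
      eq : reverse (h ++ g) ++ g ≡ reverse g ++ reverse h ++ g
      eq = ≡.trans (cong (_++ g) (reverse-++ h g)) (++-assoc (reverse g) (reverse h) g)

  Fixes-conjugate : ∀ v z g → Fixes (v ++ z ∷ reverse v) g → Fixes (z ∷ []) (reverse v ++ g)
  Fixes-conjugate v z g = subst (mem U) eq
    where
      open ≡.≡-Reasoning
      eq : reverse g ++ (v ++ z ∷ reverse v) ++ g ≡ reverse (reverse v ++ g) ++ z ∷ reverse v ++ g
      eq = begin
        reverse g ++ (v ++ z ∷ reverse v) ++ g    ≡⟨ cong (reverse g ++_) (++-assoc v (z ∷ reverse v) g) ⟩
        reverse g ++ v ++ z ∷ reverse v ++ g      ≡⟨ ++-assoc (reverse g) v (z ∷ reverse v ++ g) ⟨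
        (reverse g ++ v) ++ z ∷ reverse v ++ g    ≡⟨ cong (_++ z ∷ reverse v ++ g) (reverse-quotient v g) ⟨
        reverse (reverse v ++ g) ++ z ∷ reverse v ++ g ∎

  FixesNoCoset : Word → Set
  FixesNoCoset h = ∀ g → ¬ Fixes h g

  NoShortRotation : Gen → Gen → ℕ → Set
  NoShortRotation x y n = ∀ k → 1 ≤ k → k < n → FixesNoCoset (pow k (x ∷ y ∷ []))

  SurfaceConditions : Set
  SurfaceConditions = FixesNoCoset (a ∷ []) × FixesNoCoset (b ∷ []) × FixesNoCoset (c ∷ [])
                    × NoShortRotation a b 3 × NoShortRotation a c 2 × NoShortRotation b c d

  fpf⇔ : ∀ x → FPFInvolution Q (x ∷_) ⇔ FixesNoCoset (x ∷ [])
  fpf⇔ x = mk⇔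
    (λ F g p → proj₂ (F g) (same (from (moved⇔fixes (x ∷ []) g) p)))
    (λ N g → same (EqT⇒~ (≈rel [] g (involution x))) , λ p → N g (to (moved⇔fixes (x ∷ []) g) (coset p)))

  iter-prepend : ∀ k (y x : Gen) g → iter k (λ z → y ∷ x ∷ z) g ≡ pow k (y ∷ x ∷ []) ++ g
  iter-prepend zero y x g = refl
  iter-prepend (suc k) y x g = cong (λ w → y ∷ x ∷ w) (iter-prepend k y x g)

  rotation⇔ : ∀ k (x y : Gen) g → (iter k (λ z → y ∷ x ∷ z) g ~ g) ⇔ Fixes (pow k (x ∷ y ∷ [])) g
  rotation⇔ k x y g rewrite iter-prepend k y x g | ≡.sym (reverse-pow k (y ∷ x ∷ [])) =
    moved⇔fixes (pow k (y ∷ x ∷ [])) g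

  cycles⇔ : ∀ (x y : Gen) n → EqT d (pow n (x ∷ y ∷ [])) [] →
            OnlyCycles Q n (λ z → y ∷ x ∷ z) ⇔ NoShortRotation x y n
  cycles⇔ x y n rel = mk⇔
    (λ O k 1≤k k<n g p → proj₂ (O g) k 1≤k k<n (same (from (rotation⇔ k x y g) p)))
    (λ N g → same (from (rotation⇔ n x y g) (trivial-fixes g rel))
           , λ k 1≤k k<n p → N k 1≤k k<n g (to (rotation⇔ k x y g) (coset p)))

  surface⇒conditions : IsDegSurface Q d → SurfaceConditions
  surface⇒conditions ((fa , fb , fc , _ , c₃ , c₂) , cd) =
    to (fpf⇔ a) fa , to (fpf⇔ b) fb , to (fpf⇔ c) fc ,
    to (cycles⇔ a b 3 ab³) c₃ , to (cycles⇔ a c 2 ac²) c₂ , to (cycles⇔ b c d bcᵈ) cd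

  conditions⇒surface : SurfaceConditions → IsDegSurface Q d
  conditions⇒surface (na , nb , nc , r₃ , r₂ , rd) =
    (from (fpf⇔ a) na , from (fpf⇔ b) nb , from (fpf⇔ c) nc , transitive ,
     from (cycles⇔ a b 3 ab³) r₃ , from (cycles⇔ a c 2 ac²) r₂) ,
    from (cycles⇔ b c d bcᵈ) rd

  -- every element of ⟨x,y⟩ is a rotation (xy)ᵏ or a conjugate of x or y; so if no
  -- conjugate of x, y or of a rotation (xy)ᵏ, 0 < k < n, lies in U, then
  -- gUg⁻¹ ∩ ⟨x,y⟩ = 1
  module _ (x y : Gen) (n : ℕ) (0<n : 0 < n) (rel : EqT d (pow n (x ∷ y ∷ [])) []) where
    open Dihedral (Trels d) involution x y n 0<n rel

    reflection-fixes-none : FixesNoCoset (x ∷ []) → FixesNoCoset (y ∷ []) → ∀ k → FixesNoCoset (reflection k)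
    reflection-fixes-none Nx Ny k g p with reflection-conjugate k
    ... | v , inj₁ eq = Nx (reverse v ++ g) (Fixes-conjugate v x g (subst (λ r → Fixes r g) eq p))
    ... | v , inj₂ eq = Ny (reverse v ++ g) (Fixes-conjugate v y g (subst (λ r → Fixes r g) eq p))

    trivial-meet : FixesNoCoset (x ∷ []) → FixesNoCoset (y ∷ []) → NoShortRotation x y n → TrivMeet d U x y
    trivial-meet Nx Ny Nr g h (w , w∈⟨x,y⟩ , h≈w) p with normalForm w w∈⟨x,y⟩
    ... | zero , _ , inj₁ e = ≈trans h≈w e
    ... | suc k , k<n , inj₁ e = ⊥-elim (Nr (suc k) (s≤s z≤n) k<n g (Fixes-resp g (≈trans h≈w e) p))
    ... | k , _ , inj₂ e = ⊥-elim (reflection-fixes-none Nx Ny k g (Fixes-resp g (≈trans h≈w e) p))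

  conditions⇒cond1 : 1 ≤ d → SurfaceConditions → Cond1 d U
  conditions⇒cond1 1≤d (na , nb , nc , r₃ , r₂ , rd) =
    trivial-meet a b 3 (s≤s z≤n) ab³ na nb r₃ ,
    trivial-meet a c 2 (s≤s z≤n) ac² na nc r₂ ,
    trivial-meet b c d 1≤d bcᵈ nb nc rd

  meet⇒generator : ∀ {x y} z → Pair x y z → TrivMeet d U x y → ¬ EqT d (z ∷ []) [] → FixesNoCoset (z ∷ [])
  meet⇒generator z z∈⟨x,y⟩ M z≠1 g p = z≠1 (M g (z ∷ []) (z ∷ [] , z∈⟨x,y⟩ ∷ [] , ≈refl) p)

  meet⇒rotation : ∀ {x y n} → TrivMeet d U x y → ExactOrder d x y n → NoShortRotation x y n
  meet⇒rotation {x} {y} M order k 1≤k k<n g p = order k 1≤k k<n (M g _ (_ , alternating k , ≈refl) p)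
    where
      alternating : ∀ k → All (Pair x y) (pow k (x ∷ y ∷ []))
      alternating zero = []
      alternating (suc k) = inj₁ refl ∷ inj₂ refl ∷ alternating k

  cond1⇒conditions : Separation d → Cond1 d U → SurfaceConditions
  cond1⇒conditions sep (m-ab , m-ac , m-bc) =
    meet⇒generator a (inj₁ refl) m-ab (generator a) ,
    meet⇒generator b (inj₂ refl) m-ab (generator b) ,
    meet⇒generator c (inj₂ refl) m-ac (generator c) ,
    meet⇒rotation m-ab order-ab , meet⇒rotation m-ac order-ac , meet⇒rotation m-bc order-bc
    where open Separation sep

  -- The geodesic dual replaces γ = c by γα = ca; an isomorphism
  -- φ onto it satisfies φ(wU) = w^# φ(U), so it exists iff U is #-stable up to
  -- conjugation: u ∈ U ⇔ h⁻¹u^#h ∈ U, with h = φ(U).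

  record SharpStable (h : Word) : Set where
    constructor sharp-stable
    field stable : ∀ u → mem U u ⇔ mem U (reverse h ++ sharp u ++ h)

  mem-resp-H : Cond2 d U → ∀ {v w} → EqH d v w → mem U w → mem U v
  mem-resp-H c₂ {v} {w} e p = same (~-trans (coset {[]} {w} p) (~-sym (coset {v} {w} (c₂ _ (H-quotient∈N e)))))

  module _ (I : Iso Q (Dual Q)) where
    open Iso I
    open Inverse φ renaming (to to φ→; from to φ←)

    φ-cong : ∀ {x y} → x ~ y → φ→ x ~ φ→ y
    φ-cong {x} {y} (coset p) = coset (to-cong {x} {y} p)

    φ-injective : ∀ {x y} → φ→ x ~ φ→ y → x ~ y
    φ-injective {x} {y} (coset p) = ~-trans (~-sym (left-inverse x)) (~-trans (coset (from-cong {φ→ x} {φ→ y} p)) (left-inverse y))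
      where
        left-inverse : ∀ x → φ← (φ→ x) ~ x
        left-inverse x = coset (inverseʳ {x} {φ→ x} (S.refl {φ→ x}))

    -- φ intertwines a, b, c with a, b, ca, i.e. with a^#, b^#, c^# up to ac = ca
    φ-twisted : ∀ w → φ→ w ~ (sharp w ++ φ→ [])
    φ-twisted [] = ~-refl
    φ-twisted (a ∷ w) = ~-trans (coset (α-comm w)) (~-congˡ (a ∷ []) (φ-twisted w))
    φ-twisted (b ∷ w) = ~-trans (coset (β-comm w)) (~-congˡ (b ∷ []) (φ-twisted w))
    φ-twisted (c ∷ w) = ~-trans (coset (γ-comm w))
      (~-trans (~-congˡ (c ∷ a ∷ []) (φ-twisted w)) (EqT⇒~ (T.∙-congʳ (sharp w ++ φ→ []) (≈sym ac≈ca))))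

    iso⇒stable : SharpStable (φ→ [])
    iso⇒stable = sharp-stable λ u → mk⇔
      (λ p → same (~-trans (φ-cong (coset p)) (φ-twisted u)))
      (λ q → same (φ-injective (~-trans (coset q) (~-sym (φ-twisted u)))))

  module _ {h : Word} (st : SharpStable h) where
    open SharpStable st

    -- N ≤ U: each generator g(bac)ᵈg⁻¹ of N has trivial image under #
    stable⇒cond2 : Cond2 d U
    stable⇒cond2 _ (nc-conj g) =
      from (stable (g ++ bacd d ++ reverse g)) (resp U (≈sym trivial) (one U))
      where
        trivial : EqT d (reverse h ++ sharp (g ++ bacd d ++ reverse g) ++ h) []
        trivial = ≈trans (T.∙-congˡ (reverse h) (T.∙-congʳ h (sharp-conjugate-bacᵈ g))) (TI.inverseˡ h)
    stable⇒cond2 _ nc-one = one U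
    stable⇒cond2 _ (nc-mul p q) = mul U (stable⇒cond2 _ p) (stable⇒cond2 _ q)
    stable⇒cond2 _ (nc-inv p) = inv-closed U (stable⇒cond2 _ p)
    stable⇒cond2 _ (nc-resp e p) = resp U e (stable⇒cond2 _ p)

    -- (U/N)^# = h(U/N)h⁻¹, using (2) to pass between U and U/N
    stable⇒cond3 : Cond3 d U
    stable⇒cond3 = h , λ w → forward w , backward w
      where
        c₂ = stable⇒cond2
        forward : ∀ w → UmodNSharp d U w → UmodN d U (reverse h ++ w ++ h)
        forward w (g , (u , u∈U , g≈u) , w≈g#) =
          reverse h ++ sharp u ++ h , to (stable u) u∈U ,
          H.∙-congˡ (reverse h) (H.∙-congʳ h (≈trans w≈g# (sharp-cong g≈u)))
        backward : ∀ w → UmodN d U (reverse h ++ w ++ h) → UmodNSharp d U w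
        backward w (u , u∈U , e) = sharp w , (sharp w , w#∈U , ≈refl) , ≈sym (T⇒H (sharp-involutive w))
          where
            w#∈U : mem U (sharp w)
            w#∈U = from (stable (sharp w)) (mem-resp-H c₂
              (≈trans (T⇒H (T.∙-congˡ (reverse h) (T.∙-congʳ h (sharp-involutive w)))) e) u∈U)

  cond3⇒stable : Cond2 d U → (c₃ : Cond3 d U) → SharpStable (proj₁ c₃)
  cond3⇒stable c₂ (h , c₃) = sharp-stable λ u → mk⇔ (forward u) (backward u)
    where
      forward : ∀ u → mem U u → mem U (reverse h ++ sharp u ++ h)
      forward u p with proj₁ (c₃ (sharp u)) (u , (u , p , ≈refl) , ≈refl)
      ... | u′ , u′∈U , e = mem-resp-H c₂ e u′∈U
      backward : ∀ u → mem U (reverse h ++ sharp u ++ h) → mem U u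
      backward u q with proj₂ (c₃ (sharp u)) (_ , q , ≈refl)
      ... | g , (u′ , u′∈U , g≈u′) , u#≈g# = mem-resp-H c₂ e u′∈U
        where
          e : EqH d u u′
          e = ≈trans (T⇒H (≈sym (sharp-involutive u)))
              (≈trans (sharp-cong u#≈g#) (≈trans (T⇒H (sharp-involutive g)) g≈u′))

  twist-cong : ∀ k → (∀ u → mem U u → mem U (reverse k ++ sharp u ++ k)) →
               ∀ {x y} → x ~ y → (sharp x ++ k) ~ (sharp y ++ k)
  twist-cong k invariant {x} {y} (coset p) = coset (resp U eq (invariant _ p))
    where
      open import Relation.Binary.Reasoning.Setoid T.setoid
      eq : EqT d (reverse k ++ sharp (reverse x ++ y) ++ k) (reverse (sharp x ++ k) ++ sharp y ++ k)
      eq = begin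
        reverse k ++ sharp (reverse x ++ y) ++ k            ≈⟨ T.∙-congˡ (reverse k) (T.∙-congʳ k (sharp-quotient x y)) ⟩
        reverse k ++ (reverse (sharp x) ++ sharp y) ++ k    ≡⟨ cong (reverse k ++_) (++-assoc (reverse (sharp x)) (sharp y) k) ⟩
        reverse k ++ reverse (sharp x) ++ sharp y ++ k      ≡⟨ ++-assoc (reverse k) (reverse (sharp x)) (sharp y ++ k) ⟨
        (reverse k ++ reverse (sharp x)) ++ sharp y ++ k    ≡⟨ cong (_++ sharp y ++ k) (reverse-++ (sharp x) k) ⟨
        reverse (sharp x ++ k) ++ sharp y ++ k              ∎

  conjugate-cancel : ∀ h u → EqT d (reverse h ++ (h ++ u ++ reverse h) ++ h) u
  conjugate-cancel h u = begin
    reverse h ++ (h ++ u ++ reverse h) ++ h      ≡⟨ cong (reverse h ++_) (≡.trans (++-assoc h (u ++ reverse h) h)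
                                                      (cong (h ++_) (++-assoc u (reverse h) h))) ⟩
    reverse h ++ h ++ u ++ reverse h ++ h        ≡⟨ ++-assoc (reverse h) h (u ++ reverse h ++ h) ⟨
    (reverse h ++ h) ++ u ++ reverse h ++ h      ≈⟨ T.∙-cong (TI.inverseˡ h) (T.∙-congˡ u (TI.inverseˡ h)) ⟩
    u ++ []                                      ≡⟨ ++-identityʳ u ⟩
    u                                            ∎
    where open import Relation.Binary.Reasoning.Setoid T.setoid

  sharp-reverse-sharp : ∀ h → EqT d (sharp (reverse (sharp h))) (reverse h)
  sharp-reverse-sharp h = ≈trans (sharp-reverse (sharp h)) (TI.reverse-cong (sharp-involutive h))

  module _ {h : Word} (st : SharpStable h) where
    open SharpStable st
    private
      k⁻¹ = reverse (sharp h)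

    τ τ⁻¹ : Word → Word
    τ x = sharp x ++ h
    τ⁻¹ y = sharp y ++ k⁻¹

    stable⁻¹ : ∀ u → mem U u → mem U (reverse k⁻¹ ++ sharp u ++ k⁻¹)
    stable⁻¹ u p = subst (λ g → mem U (g ++ sharp u ++ k⁻¹)) (≡.sym (reverse-involutive (sharp h)))
      (from (stable (sharp h ++ sharp u ++ k⁻¹)) (resp U (≈sym eq) p))
      where
        open import Relation.Binary.Reasoning.Setoid T.setoid
        eq : EqT d (reverse h ++ sharp (sharp h ++ sharp u ++ k⁻¹) ++ h) u
        eq = begin
          reverse h ++ sharp (sharp h ++ sharp u ++ k⁻¹) ++ h                    ≡⟨ cong (λ g → reverse h ++ g ++ h)
                                                                                      (≡.trans (sharp-++ (sharp h) _) (cong (sharp (sharp h) ++_) (sharp-++ (sharp u) k⁻¹))) ⟩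
          reverse h ++ (sharp (sharp h) ++ sharp (sharp u) ++ sharp k⁻¹) ++ h    ≈⟨ T.∙-congˡ (reverse h) (T.∙-congʳ h
                                                                                      (T.∙-cong (sharp-involutive h) (T.∙-cong (sharp-involutive u) (sharp-reverse-sharp h)))) ⟩
          reverse h ++ (h ++ u ++ reverse h) ++ h                                ≈⟨ conjugate-cancel h u ⟩
          u                                                                      ∎

    τ-τ⁻¹ : ∀ y → τ (τ⁻¹ y) ~ y
    τ-τ⁻¹ y = EqT⇒~ (begin
      sharp (sharp y ++ k⁻¹) ++ h              ≡⟨ cong (_++ h) (sharp-++ (sharp y) k⁻¹) ⟩
      (sharp (sharp y) ++ sharp k⁻¹) ++ h      ≈⟨ T.∙-congʳ h (T.∙-cong (sharp-involutive y) (sharp-reverse-sharp h)) ⟩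
      (y ++ reverse h) ++ h                    ≡⟨ ++-assoc y (reverse h) h ⟩
      y ++ reverse h ++ h                      ≈⟨ T.∙-congˡ y (TI.inverseˡ h) ⟩
      y ++ []                                  ≡⟨ ++-identityʳ y ⟩
      y                                        ∎)
      where open import Relation.Binary.Reasoning.Setoid T.setoid

    τ⁻¹-τ : ∀ x → τ⁻¹ (τ x) ~ x
    τ⁻¹-τ x = EqT⇒~ (begin
      sharp (sharp x ++ h) ++ k⁻¹              ≡⟨ cong (_++ k⁻¹) (sharp-++ (sharp x) h) ⟩
      (sharp (sharp x) ++ sharp h) ++ k⁻¹      ≈⟨ T.∙-congʳ k⁻¹ (T.∙-congʳ (sharp h) (sharp-involutive x)) ⟩
      (x ++ sharp h) ++ k⁻¹                    ≡⟨ ++-assoc x (sharp h) k⁻¹ ⟩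
      x ++ sharp h ++ k⁻¹                      ≈⟨ T.∙-congˡ x (TI.inverseʳ (sharp h)) ⟩
      x ++ []                                  ≡⟨ ++-identityʳ x ⟩
      x                                        ∎)
      where open import Relation.Binary.Reasoning.Setoid T.setoid

    stable⇒iso : Iso Q (Dual Q)
    stable⇒iso = record
      { φ = record
        { to = τ ; from = τ⁻¹
        ; to-cong = λ {x} {y} p → same (τ-cong (coset {x} {y} p))
        ; from-cong = λ {x} {y} p → same (τ⁻¹-cong (coset {x} {y} p))
        ; inverse = (λ {x} {y} p → same (~-trans (τ-cong (coset {y} {τ⁻¹ x} p)) (τ-τ⁻¹ x)))
                  , (λ {x} {y} p → same (~-trans (τ⁻¹-cong (coset {y} {τ x} p)) (τ⁻¹-τ x))) }
      ; α-comm = λ x → same (~-refl {τ (a ∷ x)})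
      ; β-comm = λ x → same (~-refl {τ (b ∷ x)})
      ; γ-comm = λ x → same (EqT⇒~ {τ (c ∷ x)} {c ∷ a ∷ τ x} (T.∙-congʳ (τ x) ac≈ca)) }
      where
        τ-cong : ∀ {x y} → x ~ y → τ x ~ τ y
        τ-cong = twist-cong h (λ u → to (stable u))
        τ⁻¹-cong : ∀ {x y} → x ~ y → τ⁻¹ x ~ τ⁻¹ y
        τ⁻¹-cong = twist-cong k⁻¹ stable⁻¹

module Stabilizer (d : ℕ) (Q : Quad) where
  private
    module F = Setoid (F Q)
  open F using (_≈_) renaming (Carrier to Flag)
  open Action Q

  cycles-swap : ∀ {n} (f g : Flag → Flag) → (∀ {x y} → x ≈ y → g x ≈ g y) →
                FPFInvolution Q g → OnlyCycles Q n (λ z → g (f z)) → ∀ x → iter n (λ z → f (g z)) x ≈ x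
  cycles-swap {n} f g g-cong g-inv cycles x =
    F.trans (F.sym (proj₁ (g-inv _))) (F.trans (g-cong (F.trans (F.reflexive (conjugate n x)) (proj₁ (cycles (g x)))))
      (proj₁ (g-inv x)))
    where
      conjugate : ∀ n x → g (iter n (λ z → f (g z)) x) ≡ iter n (λ z → g (f z)) (g x)
      conjugate zero x = refl
      conjugate (suc n) x = cong (λ z → g (f z)) (conjugate n x)

  surface-represents : IsDegSurface Q d → Represents d
  surface-represents ((fa , fb , fc , _ , c₃ , c₂) , cd) = representation relators
    where
      power : ∀ n w x → iter n (act Q w) x ≈ x → act Q (pow n w) x ≈ x
      power n w x e = F.trans (F.reflexive (act-pow n w x)) e
      relators : ∀ {r} → r ∈ Trels d → ∀ x → act Q r x ≈ x
      relators (here refl) x = proj₁ (fa x)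
      relators (there (here refl)) x = proj₁ (fb x)
      relators (there (there (here refl))) x = proj₁ (fc x)
      relators (there (there (there (here refl)))) x =
        power 3 (a ∷ b ∷ []) x (cycles-swap (α Q) (β Q) (β-cong Q) fb c₃ x)
      relators (there (there (there (there (here refl))))) x =
        power 2 (a ∷ c ∷ []) x (cycles-swap (α Q) (γ Q) (γ-cong Q) fc c₂ x)
      relators (there (there (there (there (there (here refl)))))) x =
        power d (b ∷ c ∷ []) x (cycles-swap (β Q) (γ Q) (γ-cong Q) fc cd x)

  module _ (rep : Represents d) (x₀ : Flag) (reach : ∀ y → Σ Word λ w → act Q w x₀ ≈ y) where
    private
      module TI = Presented.Involutive (Trels d) (gg∈ {d})

    U : Subgroup d
    U = record
      { mem = λ w → act Q w x₀ ≈ x₀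
      ; resp = λ e p → F.trans (F.sym (act-resp rep e x₀)) p
      ; one = F.refl
      ; mul = λ {v} {w} p q → F.trans (F.reflexive (act-++ v w x₀)) (F.trans (act-cong v q) p)
      ; inv-closed = λ {w} p → F.trans (act-cong (reverse w) (F.sym p))
          (F.trans (F.reflexive (≡.sym (act-++ (reverse w) w x₀))) (act-resp rep (TI.inverseˡ w) x₀))
      }

    same-coset⇔ : ∀ g h → mem U (reverse g ++ h) ⇔ (act Q h x₀ ≈ act Q g x₀)
    same-coset⇔ g h = mk⇔
      (λ p → F.trans (F.sym (act-resp rep (TI.inverseʳ g) (act Q h x₀)))
        (F.trans (F.reflexive (≡.trans (act-++ g (reverse g) (act Q h x₀)) (cong (act Q g) (≡.sym (act-++ (reverse g) h x₀)))))
        (act-cong g p)))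
      (λ e → F.trans (F.reflexive (act-++ (reverse g) h x₀))
        (F.trans (act-cong (reverse g) e)
        (F.trans (F.reflexive (≡.sym (act-++ (reverse g) g x₀))) (act-resp rep (TI.inverseˡ g) x₀))))

    word : Flag → Word
    word y = proj₁ (reach y)

    word-reaches : ∀ y → act Q (word y) x₀ ≈ y
    word-reaches y = proj₂ (reach y)

    word-comm : ∀ (g : Gen) (f : Flag → Flag) → (∀ {x y} → x ≈ y → f x ≈ f y) →
                (∀ w x → act Q (g ∷ w) x ≡ f (act Q w x)) →
                ∀ y → mem U (reverse (word (f y)) ++ g ∷ word y)
    word-comm g f f-cong act-g y = Equivalence.from (same-coset⇔ (word (f y)) (g ∷ word y))
      (F.trans (F.reflexive (act-g (word y) x₀)) (F.trans (f-cong (word-reaches y)) (F.sym (word-reaches (f y)))))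

    iso : Iso Q (CosetSurface d U)
    iso = record
      { φ = record
        { to = word
        ; from = λ w → act Q w x₀
        ; to-cong = λ {y} {y′} e → Equivalence.from (same-coset⇔ (word y) (word y′))
            (F.trans (word-reaches y′) (F.trans (F.sym e) (F.sym (word-reaches y))))
        ; from-cong = λ {g} {h} p → F.sym (Equivalence.to (same-coset⇔ g h) p)
        ; inverse = (λ {g} {y} e → Equivalence.from (same-coset⇔ (word y) g) (F.trans (F.sym e) (F.sym (word-reaches y))))
                  , (λ {y} {g} p → F.trans (F.sym (Equivalence.to (same-coset⇔ g (word y)) p)) (word-reaches y)) }
      ; α-comm = word-comm a (α Q) (α-cong Q) (λ _ _ → refl)
      ; β-comm = word-comm b (β Q) (β-cong Q) (λ _ _ → refl)
      ; γ-comm = word-comm c (γ Q) (γ-cong Q) (λ _ _ → refl) }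

  surface≅cosets : IsDegSurface Q d → Σ (Subgroup d) λ U → Iso Q (CosetSurface d U)
  surface≅cosets S = U rep x₀ reach , iso rep x₀ reach
    where
      rep = surface-represents S
      x₀ = proj₁ (proj₁ (proj₂ (proj₂ (proj₂ (proj₁ S)))))
      reach = proj₂ (proj₁ (proj₂ (proj₂ (proj₂ (proj₁ S))))) x₀

-- There is no degree-1 case: in T₁ we have c = b, so bac ∈ N lies in ⟨a,b⟩,
-- and (1) and (2) would force bac = 1, contradicting parity.
no-degree-one : (U : Subgroup 1) → Cond1 1 U → Cond2 1 U → ⊥
no-degree-one U (meet-ab , _ , _) N≤U =
  Parity.bac≠1 1 (meet-ab [] (b ∷ a ∷ c ∷ []) (b ∷ a ∷ b ∷ [] , inj₂ refl ∷ inj₁ refl ∷ inj₂ refl ∷ [] , bac≈bab)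
                          (N≤U _ (nc-conj [])))
  where
    open Groups 1
    c≈b : EqT 1 (c ∷ []) (b ∷ [])
    c≈b = ≈trans (≈sym (≈rel [] (c ∷ []) (involution b))) (≈rel (b ∷ []) [] (there (there (there (there (there (here refl)))))))
    bac≈bab : EqT 1 (b ∷ a ∷ c ∷ []) (b ∷ a ∷ b ∷ [])
    bac≈bab = T.∙-congˡ (b ∷ a ∷ []) c≈b

self-dual⇒conditions : ∀ d → 1 ≤ d → (U : Subgroup d) →
                       IsGSDSurface d (CosetSurface d U) → Cond1 d U × Cond2 d U × Cond3 d U
self-dual⇒conditions d 1≤d U (surface , dual) =
  conditions⇒cond1 1≤d (surface⇒conditions surface) , stable⇒cond2 stable , stable⇒cond3 stable
  where
    open Cosets d U
    stable = iso⇒stable dual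

conditions⇒self-dual : ∀ d → 1 ≤ d → (U : Subgroup d) →
                       Cond1 d U × Cond2 d U × Cond3 d U → IsGSDSurface d (CosetSurface d U)
conditions⇒self-dual (suc zero) _ U (c₁ , c₂ , _) = ⊥-elim (no-degree-one U c₁ c₂)
conditions⇒self-dual d@(suc (suc _)) _ U (c₁ , c₂ , c₃) =
  conditions⇒surface (cond1⇒conditions (separation d (s≤s (s≤s z≤n))) c₁) ,
  stable⇒iso (cond3⇒stable c₂ c₃)
  where open Cosets d U

corollary4p15 : (d : ℕ) → 1 ≤ d →
    ((U : Subgroup d) →
    (IsGSDSurface d (CosetSurface d U) ⇔ (Cond1 d U × Cond2 d U × Cond3 d U)))
    × ((S : Quad) → IsGSDSurface d S → Σ (Subgroup d) (λ U → Iso S (CosetSurface d U)))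
corollary4p15 d 1≤d =
    (λ U → mk⇔ (self-dual⇒conditions d 1≤d U) (conditions⇒self-dual d 1≤d U))
  , (λ S (surface , _) → Stabilizer.surface≅cosets d S surface)
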